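{- Let $q\ge0$, $t\ge1$, $k\ge1$ be integers. Every critical configuration $[c_1,\dots,c_k]$ of the dollar game on $W_k(q,t)$ has at least one entry $c_i\in\{1+q,\dots,q+t\}$.
   Context: $W_k(q,t)$ is the directed multigraph with hub $v_0$ and rim vertices $v_1,\dots,v_k$ in clockwise order (indices mod $k$), with $t$ edges each way between $v_0$ and each $v_i$, one edge $v_i\to v_{i-1}$ and $q$ edges $v_i\to v_{i+1}$. Dollar game: a configuration is a vector $C=[c_1,\dots,c_k]$ of nonnegative integers; the bank $v_0$ holds $c_0=-(c_1+\dots+c_k)$. A rim vertex $v_i$ may fire if $c_i\ge 1+q+t$; firing decreases $c_i$ by $1+q+t$, increases $c_{i+1}$ by $q$, $c_{i-1}$ by $1$ (indices mod $k$) and $c_0$ by $t$. The bank may fire only when no rim vertex can fire; firing it adds $t$ to every $c_i$ and subtracts $kt$ from $c_0$. A configuration is stable if no rim vertex can fire, recurrent if some nonempty legal sequence of firings leads from it back to itself, and critical if it is both stable and recurrent. -}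

module Defs where

open import Data.Nat using (ℕ; zero; suc; _+_; _∸_; _≤_; _<_)
open import Data.Nat.DivMod using (_mod_)
open import Data.Fin using (Fin; toℕ; _≟_)
open import Data.Vec using (Vec; lookup; tabulate)
open import Data.Bool using (if_then_else_)
open import Data.Product using (∃; _×_)
open import Relation.Nullary using (¬_)
open import Relation.Nullary.Decidable using (⌊_⌋)
open import Relation.Binary.Construct.Closure.Transitive using (TransClosure)

-- Rim vertices v_1..v_k are indexed by Fin k with k = suc n (so k ≥ 1);
-- Fin index j stands for v_{j+1}.  Indices are taken mod k.
Config : ℕ → Set
Config n = Vec ℕ (suc n)

nextV : ∀ {n} → Fin (suc n) → Fin (suc n)
nextV {n} i = (suc (toℕ i)) mod (suc n)

prevV : ∀ {n} → Fin (suc n) → Fin (suc n)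
prevV {n} i = (toℕ i + n) mod (suc n)

[_≡ᶠ_]·_ : ∀ {n} → Fin n → Fin n → ℕ → ℕ
[ j ≡ᶠ i ]· a = if ⌊ j ≟ i ⌋ then a else 0

CanFire : (q t : ℕ) {n : ℕ} → Config n → Fin (suc n) → Set
CanFire q t C i = 1 + q + t ≤ lookup C i

-- effect of firing rim vertex i (only used when CanFire holds, so ∸ is exact).
-- Loops for k = 1 and coinciding neighbours for k = 2 are handled by the
-- indicators adding up.
fireRim : (q t : ℕ) {n : ℕ} → Fin (suc n) → Config n → Config n
fireRim q t i C = tabulate λ j →
  (lookup C j ∸ [ j ≡ᶠ i ]· (1 + q + t)) + [ j ≡ᶠ nextV i ]· q + [ j ≡ᶠ prevV i ]· 1

fireBank : (t : ℕ) {n : ℕ} → Config n → Config n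
fireBank t C = tabulate λ j → lookup C j + t

Stable : (q t : ℕ) {n : ℕ} → Config n → Set
Stable q t C = ∀ i → ¬ CanFire q t C i

-- one legal firing (the bank's holding c_0 = -(c_1+...+c_k) is determined
-- by the rim configuration, so it need not be tracked)
data Step (q t : ℕ) {n : ℕ} : Config n → Config n → Set where
  rim  : ∀ {C} i → CanFire q t C i → Step q t C (fireRim q t i C)
  bank : ∀ {C} → Stable q t C → Step q t C (fireBank t C)

Recurrent : (q t : ℕ) {n : ℕ} → Config n → Set
Recurrent q t C = TransClosure (Step q t) C C

Critical : (q t : ℕ) {n : ℕ} → Config n → Set
Critical q t C = Stable q t C × Recurrent q t C

-- A cycle of firings returning to a critical configuration C must begin with
-- the bank (C is stable), which hands t ≥ 1 chips to every rim vertex; a rim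
-- vertex that never fired afterwards would end strictly richer than in C, so
-- every rim vertex fires on the cycle.  Take the vertex v whose last firing
-- comes earliest.  After it v never fires again while both its neighbours do,
-- so on top of a nonnegative balance v collects q chips from its predecessor
-- and 1 from its successor (for k ≤ 2 these coincide and a single firing
-- delivers both): back at C, c_v ≥ 1 + q.  Stability gives c_v ≤ q + t.
module Submission where

open import Defs
open import Data.Nat using (ℕ; suc; _+_; _∸_; _≤_; NonZero; _%_)
open import Data.Nat.Properties hiding (_≟_)
open import Data.Nat.DivMod using (%-distribˡ-+; m%n%n≡m%n; [m+n]%n≡m%n; m<n⇒m%n≡m; m%n<n)
open import Algebra.Properties.CommutativeSemigroup +-commutativeSemigroup using (xy∙z≈xz∙y)
open import Data.Fin using (Fin; zero; toℕ; _≟_)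
open import Data.Fin.Properties using (toℕ-fromℕ<; toℕ-injective; toℕ<n; all?; ¬∀⟶∃¬)
open import Data.Vec using (lookup)
open import Data.Vec.Properties using (lookup∘tabulate)
open import Function using (_∘′_)
open import Data.Empty using (⊥; ⊥-elim)
open import Data.Sum using (_⊎_; inj₁; inj₂)
open import Data.Product using (∃; _×_; _,_)
open import Relation.Nullary using (¬_; Dec; yes; no)
open import Relation.Nullary.Decidable using (_⊎-dec_; decidable-stable)
open import Relation.Binary.Core using (Rel)
open import Relation.Binary.PropositionalEquality
open import Relation.Binary.Construct.Closure.Transitive using (TransClosure; [_]; _∷_)
open import Relation.Binary.Construct.Closure.ReflexiveTransitive using (Star; ε; _◅_)

TransClosure⇒◅Star : ∀ {a ℓ} {A : Set a} {R : Rel A ℓ} {x z : A} →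
  TransClosure R x z → ∃ λ y → R x y × Star R y z
TransClosure⇒◅Star [ r ] = _ , r , ε
TransClosure⇒◅Star (r ∷ rs) with TransClosure⇒◅Star rs
... | _ , r′ , rs′ = _ , r , r′ ◅ rs′

[m%d+n]%d≡[m+n]%d : ∀ m n d .{{_ : NonZero d}} → (m % d + n) % d ≡ (m + n) % d
[m%d+n]%d≡[m+n]%d m n d = begin
  (m % d + n) % d          ≡⟨ %-distribˡ-+ (m % d) n d ⟩
  (m % d % d + n % d) % d  ≡⟨ cong (λ x → (x + n % d) % d) (m%n%n≡m%n m d) ⟩
  (m % d + n % d) % d      ≡⟨ %-distribˡ-+ m n d ⟨
  (m + n) % d              ∎
  where open ≡-Reasoning

[m+n%d]%d≡[m+n]%d : ∀ m n d .{{_ : NonZero d}} → (m + n % d) % d ≡ (m + n) % d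
[m+n%d]%d≡[m+n]%d m n d = begin
  (m + n % d) % d  ≡⟨ cong (_% d) (+-comm m (n % d)) ⟩
  (n % d + m) % d  ≡⟨ [m%d+n]%d≡[m+n]%d n m d ⟩
  (n + m) % d      ≡⟨ cong (_% d) (+-comm n m) ⟩
  (m + n) % d      ∎
  where open ≡-Reasoning

module _ {n : ℕ} where

  suc[i+n]%[1+n]≡i : (i : Fin (suc n)) → suc (toℕ i + n) % suc n ≡ toℕ i
  suc[i+n]%[1+n]≡i i = begin
    suc (toℕ i + n) % suc n  ≡⟨ cong (_% suc n) (+-suc (toℕ i) n) ⟨
    (toℕ i + suc n) % suc n  ≡⟨ [m+n]%n≡m%n (toℕ i) (suc n) ⟩
    toℕ i % suc n            ≡⟨ m<n⇒m%n≡m (toℕ<n i) ⟩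
    toℕ i                    ∎
    where open ≡-Reasoning

  nextV∘prevV : (i : Fin (suc n)) → nextV (prevV i) ≡ i
  nextV∘prevV i = toℕ-injective (begin
    toℕ (nextV (prevV i))               ≡⟨ toℕ-fromℕ< _ ⟩
    suc (toℕ (prevV i)) % suc n         ≡⟨ cong (λ x → suc x % suc n) (toℕ-fromℕ< (m%n<n (toℕ i + n) (suc n))) ⟩
    (1 + (toℕ i + n) % suc n) % suc n   ≡⟨ [m+n%d]%d≡[m+n]%d 1 (toℕ i + n) (suc n) ⟩
    suc (toℕ i + n) % suc n             ≡⟨ suc[i+n]%[1+n]≡i i ⟩
    toℕ i                               ∎)
    where open ≡-Reasoning

  prevV∘nextV : (i : Fin (suc n)) → prevV (nextV i) ≡ i
  prevV∘nextV i = toℕ-injective (begin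
    toℕ (prevV (nextV i))               ≡⟨ toℕ-fromℕ< _ ⟩
    (toℕ (nextV i) + n) % suc n         ≡⟨ cong (λ x → (x + n) % suc n) (toℕ-fromℕ< (m%n<n (suc (toℕ i)) (suc n))) ⟩
    (suc (toℕ i) % suc n + n) % suc n   ≡⟨ [m%d+n]%d≡[m+n]%d (suc (toℕ i)) n (suc n) ⟩
    suc (toℕ i + n) % suc n             ≡⟨ suc[i+n]%[1+n]≡i i ⟩
    toℕ i                               ∎)
    where open ≡-Reasoning

  nextV-fixed⇒prevV-fixed : {i : Fin (suc n)} → nextV i ≡ i → prevV i ≡ i
  nextV-fixed⇒prevV-fixed {i} next≡i = trans (cong prevV (sym next≡i)) (prevV∘nextV i)

  prevV-fixed⇒nextV-fixed : {i : Fin (suc n)} → prevV i ≡ i → nextV i ≡ i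
  prevV-fixed⇒nextV-fixed {i} prev≡i = trans (cong nextV (sym prev≡i)) (nextV∘prevV i)

module _ {m : ℕ} {j i : Fin m} where

  [≡ᶠ]·-≡ : (a : ℕ) → j ≡ i → [ j ≡ᶠ i ]· a ≡ a
  [≡ᶠ]·-≡ a j≡i with j ≟ i
  ... | yes _   = refl
  ... | no j≢i  = ⊥-elim (j≢i j≡i)

  [≢ᶠ]·-≡0 : (a : ℕ) → j ≢ i → [ j ≡ᶠ i ]· a ≡ 0
  [≢ᶠ]·-≡0 a j≢i with j ≟ i
  ... | yes j≡i = ⊥-elim (j≢i j≡i)
  ... | no _    = refl

module _ (q t : ℕ) {n : ℕ} where

  private
    V : Set
    V = Fin (suc n)

    variable
      C D E : Config n
      i j a b : V

  received : V → V → ℕ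
  received j v = [ j ≡ᶠ nextV v ]· q + [ j ≡ᶠ prevV v ]· 1

  lookup-fireRim : ∀ C i j →
    lookup (fireRim q t i C) j ≡ (lookup C j ∸ [ j ≡ᶠ i ]· (1 + q + t)) + received j i
  lookup-fireRim C i j = trans
    (lookup∘tabulate (λ j → rest j + [ j ≡ᶠ nextV i ]· q + [ j ≡ᶠ prevV i ]· 1) j)
    (+-assoc (rest j) ([ j ≡ᶠ nextV i ]· q) ([ j ≡ᶠ prevV i ]· 1))
    where
    rest : V → ℕ
    rest j = lookup C j ∸ [ j ≡ᶠ i ]· (1 + q + t)

  lookup-fireRim-≢ : ∀ C → j ≢ i → lookup (fireRim q t i C) j ≡ lookup C j + received j i
  lookup-fireRim-≢ {j} {i} C j≢i = trans (lookup-fireRim C i j)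
    (cong (λ x → (lookup C j ∸ x) + received j i) ([≢ᶠ]·-≡0 (1 + q + t) j≢i))

  received≤lookup-fireRim : ∀ C i → received i i ≤ lookup (fireRim q t i C) i
  received≤lookup-fireRim C i =
    ≤-trans (m≤n+m (received i i) (lookup C i ∸ [ i ≡ᶠ i ]· (1 + q + t)))
            (≤-reflexive (sym (lookup-fireRim C i i)))

  lookup-fireBank : (C : Config n) (j : V) → lookup (fireBank t C) j ≡ lookup C j + t
  lookup-fireBank C j = lookup∘tabulate (λ j → lookup C j + t) j

  q≤received-prevV : ∀ j → q ≤ received j (prevV j)
  q≤received-prevV j =
    ≤-trans (≤-reflexive (sym ([≡ᶠ]·-≡ q (sym (nextV∘prevV j))))) (m≤m+n _ _)

  1≤received-nextV : ∀ j → 1 ≤ received j (nextV j)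
  1≤received-nextV j =
    ≤-trans (≤-reflexive (sym ([≡ᶠ]·-≡ 1 (sym (prevV∘nextV j))))) (m≤n+m _ _)

  received-≡ : nextV a ≡ j → prevV a ≡ j → received j a ≡ 1 + q
  received-≡ next≡j prev≡j =
    trans (cong₂ _+_ ([≡ᶠ]·-≡ q (sym next≡j)) ([≡ᶠ]·-≡ 1 (sym prev≡j))) (+-comm q 1)

  StepFires : V → Step q t C D → Set
  StepFires j (rim i _) = j ≡ i
  StepFires j (bank _)  = ⊥

  Fires : V → Star (Step q t) C D → Set
  Fires j ε       = ⊥
  Fires j (s ◅ π) = StepFires j s ⊎ Fires j π

  stepFires? : ∀ j (s : Step q t C D) → Dec (StepFires j s)
  stepFires? j (rim i _) = j ≟ i
  stepFires? j (bank _)  = no λ ()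

  fires? : ∀ j (π : Star (Step q t) C D) → Dec (Fires j π)
  fires? j ε       = no λ ()
  fires? j (s ◅ π) = stepFires? j s ⊎-dec fires? j π

  stepFires-unique : (s : Step q t C D) → StepFires i s → StepFires j s → j ≡ i
  stepFires-unique (rim _ _) i≡v j≡v = trans j≡v (sym i≡v)

  step-mono : (s : Step q t C D) → ¬ StepFires j s → lookup C j ≤ lookup D j
  step-mono {C} (rim i _) j≢i =
    ≤-trans (m≤m+n _ _) (≤-reflexive (sym (lookup-fireRim-≢ C j≢i)))
  step-mono {C} {j = j} (bank _) _ =
    ≤-trans (m≤m+n _ t) (≤-reflexive (sym (lookup-fireBank C j)))

  ¬Fires⇒mono : (π : Star (Step q t) C D) → ¬ Fires j π → lookup C j ≤ lookup D j
  ¬Fires⇒mono ε       _  = ≤-refl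
  ¬Fires⇒mono (s ◅ π) ¬fires =
    ≤-trans (step-mono s (¬fires ∘′ inj₁)) (¬Fires⇒mono π (¬fires ∘′ inj₂))

  ¬Fires∧Fires⇒received≤ : (π : Star (Step q t) C D) → ¬ Fires j π → Fires a π →
    lookup C j + received j a ≤ lookup D j
  ¬Fires∧Fires⇒received≤ {C} (rim _ _ ◅ π) ¬fires (inj₁ refl) =
    ≤-trans (≤-reflexive (sym (lookup-fireRim-≢ C (¬fires ∘′ inj₁))))
      (¬Fires⇒mono π (¬fires ∘′ inj₂))
  ¬Fires∧Fires⇒received≤ (s ◅ π) ¬fires (inj₂ fa) =
    ≤-trans (+-monoˡ-≤ _ (step-mono s (¬fires ∘′ inj₁)))
      (¬Fires∧Fires⇒received≤ π (¬fires ∘′ inj₂) fa)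

  ¬Fires∧Fires₂⇒received≤ : (π : Star (Step q t) C D) → ¬ Fires j π →
    Fires a π → Fires b π → a ≢ b →
    lookup C j + received j a + received j b ≤ lookup D j
  ¬Fires∧Fires₂⇒received≤ (s ◅ π) ¬fires (inj₂ fa) (inj₂ fb) a≢b =
    ≤-trans (+-monoˡ-≤ _ (+-monoˡ-≤ _ (step-mono s (¬fires ∘′ inj₁))))
      (¬Fires∧Fires₂⇒received≤ π (¬fires ∘′ inj₂) fa fb a≢b)
  ¬Fires∧Fires₂⇒received≤ {C} (rim _ _ ◅ π) ¬fires (inj₁ refl) (inj₂ fb) _ =
    ≤-trans (≤-reflexive (cong (_+ _) (sym (lookup-fireRim-≢ C (¬fires ∘′ inj₁)))))
      (¬Fires∧Fires⇒received≤ π (¬fires ∘′ inj₂) fb)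
  ¬Fires∧Fires₂⇒received≤ {C} {j = j} {a} {b} (rim _ _ ◅ π) ¬fires (inj₂ fa) (inj₁ refl) _ =
    ≤-trans (≤-reflexive (trans (xy∙z≈xz∙y (lookup C j) (received j a) (received j b))
                                (cong (_+ _) (sym (lookup-fireRim-≢ C (¬fires ∘′ inj₁))))))
      (¬Fires∧Fires⇒received≤ π (¬fires ∘′ inj₂) fa)
  ¬Fires∧Fires₂⇒received≤ (rim _ _ ◅ π) _ (inj₁ refl) (inj₁ refl) a≢b = ⊥-elim (a≢b refl)

  neighbours-fire⇒rich : (π : Star (Step q t) D E) → ¬ Fires i π → nextV i ≢ i →
    (∀ j → j ≢ i → Fires j π) → 1 + q ≤ lookup E i
  neighbours-fire⇒rich {D} {E} {i} π ¬fires next≢i others with prevV i ≟ nextV i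
  ... | yes prev≡next = begin
    1 + q                          ≡⟨ received-≡ (nextV∘prevV i) prev∘prev≡i ⟨
    received i (prevV i)           ≤⟨ m≤n+m (received i (prevV i)) (lookup D i) ⟩
    lookup D i + received i (prevV i)
                                   ≤⟨ ¬Fires∧Fires⇒received≤ π ¬fires (others _ prev≢i) ⟩
    lookup E i                     ∎
    where
    open ≤-Reasoning
    prev∘prev≡i : prevV (prevV i) ≡ i
    prev∘prev≡i = trans (cong prevV prev≡next) (prevV∘nextV i)
    prev≢i : prevV i ≢ i
    prev≢i = next≢i ∘′ prevV-fixed⇒nextV-fixed
  ... | no prev≢next = begin
    1 + q                   ≡⟨ +-comm 1 q ⟩
    q + 1                   ≤⟨ +-mono-≤ (q≤received-prevV i) (1≤received-nextV i) ⟩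
    rₚ + rₙ                 ≤⟨ m≤n+m (rₚ + rₙ) (lookup D i) ⟩
    lookup D i + (rₚ + rₙ)  ≡⟨ +-assoc (lookup D i) rₚ rₙ ⟨
    lookup D i + rₚ + rₙ    ≤⟨ ¬Fires∧Fires₂⇒received≤ π ¬fires
                                 (others _ prev≢i) (others _ next≢i) prev≢next ⟩
    lookup E i              ∎
    where
    open ≤-Reasoning
    rₚ rₙ : ℕ
    rₚ = received i (prevV i)
    rₙ = received i (nextV i)
    prev≢i : prevV i ≢ i
    prev≢i = next≢i ∘′ prevV-fixed⇒nextV-fixed

  rich-after-last-firing : (s : Step q t C D) → StepFires i s →
    (π : Star (Step q t) D E) → ¬ Fires i π → (∀ j → j ≢ i → Fires j π) →
    1 + q ≤ lookup E i
  rich-after-last-firing {C} {i = i} {E = E} (rim i _) refl π ¬fires others with nextV i ≟ i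
  ... | no next≢i = neighbours-fire⇒rich π ¬fires next≢i others
  ... | yes next≡i = begin
    1 + q                       ≡⟨ received-≡ next≡i (nextV-fixed⇒prevV-fixed next≡i) ⟨
    received i i                ≤⟨ received≤lookup-fireRim C i ⟩
    lookup (fireRim q t i C) i  ≤⟨ ¬Fires⇒mono π ¬fires ⟩
    lookup E i                  ∎
    where open ≤-Reasoning

  allFire⇒rich : (π : Star (Step q t) C D) → (∀ j → Fires j π) →
    ∃ λ i → 1 + q ≤ lookup D i
  allFire⇒rich ε allFire = ⊥-elim (allFire zero)
  allFire⇒rich (s ◅ π) allFire with all? (λ j → fires? j π)
  ... | yes allFireπ = allFire⇒rich π allFireπ
  ... | no ¬allFireπ with ¬∀⟶∃¬ _ _ (λ j → fires? j π) ¬allFireπ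
  ...   | i , ¬fires with allFire i
  ...     | inj₂ fires = ⊥-elim (¬fires fires)
  ...     | inj₁ fires = i , rich-after-last-firing s fires π ¬fires others
    where
    others : ∀ j → j ≢ i → Fires j π
    others j j≢i with allFire j
    ... | inj₁ firesⱼ = ⊥-elim (j≢i (stepFires-unique s fires firesⱼ))
    ... | inj₂ firesⱼ = firesⱼ

  cycle-fires-everywhere : Stable q t C → 1 ≤ t →
    (s : Step q t C D) (π : Star (Step q t) D C) → ∀ j → Fires j (s ◅ π)
  cycle-fires-everywhere stable _ (rim i canFire) _ _ = ⊥-elim (stable i canFire)
  cycle-fires-everywhere {C} _ 1≤t s@(bank _) π j =
    decidable-stable (fires? j (s ◅ π)) λ ¬fires → n≮n (lookup C j) (begin-strict
      lookup C j                ≡⟨ +-identityʳ _ ⟨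
      lookup C j + 0            <⟨ +-monoʳ-< (lookup C j) 1≤t ⟩
      lookup C j + t            ≡⟨ lookup-fireBank C j ⟨
      lookup (fireBank t C) j   ≤⟨ ¬Fires⇒mono π (¬fires ∘′ inj₂) ⟩
      lookup C j                ∎)
    where open ≤-Reasoning

lemma3 : (q t n : ℕ) → 1 ≤ t → (C : Config n) → Critical q t C →
    ∃ λ (i : Fin (suc n)) → 1 + q ≤ lookup C i × lookup C i ≤ q + t
lemma3 q t n 1≤t C (stable , cycle) with TransClosure⇒◅Star cycle
... | _ , s , π with allFire⇒rich q t (s ◅ π) (cycle-fires-everywhere q t stable 1≤t s π)
... | i , rich = i , rich , ≤-pred (≰⇒> (stable i))
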